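{- Let $z$ be a real irrational number with negative regular continued fraction expansion $z=\lceil c_0,c_1,c_2,\ldots\rceil$, and let $s_j/t_j$, $j\ge 1$, be a $\lceil\ \rceil$-convergent of $z$. Then $s_j/t_j$ is a $\lfloor\ \rfloor$-convergent of $z$ if and only if $c_{j+1}\ge 3$. In particular, the sequence $s_j/t_j$, $j\ge 1$, contains infinitely many $\lfloor\ \rfloor$-convergents of $z$.
   Context: For real irrational $z$, the regular continued fraction expansion $z=\lfloor a_0,a_1,a_2,\ldots\rfloor$ is given by $z_0=z$, $a_0=\lfloor z_0\rfloor$, $z_{j+1}=1/(z_j-a_j)$, $a_{j+1}=\lfloor z_{j+1}\rfloor$; its convergents ($\lfloor\ \rfloor$-convergents) are $p_k/q_k$ with $p_{ -1}=1,q_{ -1}=0,p_0=a_0,q_0=1$, $p_{k+1}=a_{k+1}p_k+p_{k-1}$, $q_{k+1}=a_{k+1}q_k+q_{k-1}$. The negative regular continued fraction expansion $z=\lceil c_0,c_1,c_2,\ldots\rceil$, meaning $z=c_0-\cfrac{1}{c_1-\cfrac{1}{c_2-\cdots}}$, is given by $z_0=z$, $c_0=\lceil z_0\rceil$, $z_{j+1}=1/(c_j-z_j)$, $c_{j+1}=\lceil z_{j+1}\rceil$; its convergents ($\lceil\ \rceil$-convergents) are $s_j/t_j$ with $s_{ -1}=1,t_{ -1}=0,s_0=c_0,t_0=1$, $s_{j+1}=c_{j+1}s_j-s_{j-1}$, $t_{j+1}=c_{j+1}t_j-t_{j-1}$. -}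

module Defs where

open import Data.Nat using (ℕ; zero; suc)
open import Data.Integer as ℤ using (ℤ; +_)
open import Data.Rational as ℚ using (ℚ; Positive; _/_; 0ℚ)
open import Data.Rational.Properties using (pos⇒nonZero)
open import Data.Product using (Σ; ∃; _×_)
open import Data.Sum using (_⊎_)
open import Relation.Nullary using (¬_; Dec)
open import Function.Bundles using (_⇔_)

⟦_⟧ : ℤ → ℚ
⟦ n ⟧ = n / 1

recip⁺ : (q : ℚ) → Positive q → ℚ
recip⁺ q pos = ℚ.1/_ q {{pos⇒nonZero q {{pos}}}}

-- A real number given by its (strict) lower Dedekind cut  {q ∈ ℚ | q < z}.
Cut : Set₁
Cut = ℚ → Set

-- Real irrational numbers, as Dedekind cuts L = {q | q < z} whose complement
-- U = {q | z < q} is also open (so z is not rational).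
record Irrational : Set₁ where
  field
    lower        : Cut
    lower?       : ∀ q → Dec (lower q)
    inhabited    : ∃ λ q → lower q
    bounded      : ∃ λ q → ¬ lower q
    down-closed  : ∀ p q → p ℚ.≤ q → lower q → lower p
    lower-open   : ∀ q → lower q → ∃ λ r → q ℚ.< r × lower r
    upper-open   : ∀ q → ¬ lower q → ∃ λ r → r ℚ.< q × ¬ lower r
open Irrational public

-- n = ⌊z⌋ for irrational z :  n < z < n+1.
IsFloor : Cut → ℤ → Set
IsFloor L n = L ⟦ n ⟧ × ¬ L ⟦ n ℤ.+ ℤ.1ℤ ⟧

-- n = ⌈z⌉ for irrational z :  n-1 < z < n.
IsCeil : Cut → ℤ → Set
IsCeil L n = L ⟦ n ℤ.- ℤ.1ℤ ⟧ × ¬ L ⟦ n ⟧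

-- L' is the cut of 1/(z - a), where L is the cut of z and a = ⌊z⌋:
-- for q > 0,  q < 1/(z-a)  ⇔  z < a + 1/q;  and every q ≤ 0 lies below.
RegStep : Cut → ℤ → Cut → Set
RegStep L a L' = ∀ q → L' q ⇔ (q ℚ.≤ 0ℚ ⊎ Σ (Positive q) λ pos → ¬ L (⟦ a ⟧ ℚ.+ recip⁺ q pos))

-- L' is the cut of 1/(c - z), where L is the cut of z and c = ⌈z⌉:
-- for q > 0,  q < 1/(c-z)  ⇔  c - 1/q < z.
NegStep : Cut → ℤ → Cut → Set
NegStep L c L' = ∀ q → L' q ⇔ (q ℚ.≤ 0ℚ ⊎ Σ (Positive q) λ pos → L (⟦ c ⟧ ℚ.- recip⁺ q pos))

-- a is the regular continued fraction expansion ⌊a₀,a₁,…⌋ of z,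
-- zs j being the complete quotients z_j.
IsRegularCF : Irrational → (ℕ → ℤ) → Set₁
IsRegularCF z a = Σ (ℕ → Cut) λ zs →
  (∀ q → zs zero q ⇔ lower z q) ×
  (∀ j → IsFloor (zs j) (a j)) ×
  (∀ j → RegStep (zs j) (a j) (zs (suc j)))

IsNegativeCF : Irrational → (ℕ → ℤ) → Set₁
IsNegativeCF z c = Σ (ℕ → Cut) λ zs →
  (∀ q → zs zero q ⇔ lower z q) ×
  (∀ j → IsCeil (zs j) (c j)) ×
  (∀ j → NegStep (zs j) (c j) (zs (suc j)))

-- Shifted numerators/denominators: P a (suc k) = p_k, P a 0 = p_{-1}, etc.
P Q : (ℕ → ℤ) → ℕ → ℤ
P a zero = ℤ.1ℤ
P a (suc zero) = a zero
P a (suc (suc k)) = a (suc k) ℤ.* P a (suc k) ℤ.+ P a k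
Q a zero = ℤ.0ℤ
Q a (suc zero) = ℤ.1ℤ
Q a (suc (suc k)) = a (suc k) ℤ.* Q a (suc k) ℤ.+ Q a k

-- S c (suc j) = s_j, T c (suc j) = t_j, with S c 0 = s_{-1}, T c 0 = t_{-1}.
S T : (ℕ → ℤ) → ℕ → ℤ
S c zero = ℤ.1ℤ
S c (suc zero) = c zero
S c (suc (suc j)) = c (suc j) ℤ.* S c (suc j) ℤ.- S c j
T c zero = ℤ.0ℤ
T c (suc zero) = ℤ.1ℤ
T c (suc (suc j)) = c (suc j) ℤ.* T c (suc j) ℤ.- T c j

-- The fraction s/t (t > 0) equals some ⌊ ⌋-convergent p_k/q_k (k ≥ 0) of the
-- expansion a; equality of fractions with positive denominators as s·q_k = p_k·t.
IsRegConvergent : (ℕ → ℤ) → ℤ → ℤ → Set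
IsRegConvergent a s t = ∃ λ k → s ℤ.* Q a (suc k) ≡ P a (suc k) ℤ.* t
  where open import Relation.Binary.PropositionalEquality using (_≡_)

{-# OPTIONS --safe #-}
-- Singularisation. Let z_k and w_i be the complete quotients of the two expansions. If
-- w_{i+1} = 1 + 1/(z_{k+1} - n) with 1 ≤ n ≤ a_{k+1}, then for n < a_{k+1} one has c_{i+1} = 2 and
-- w_{i+2} = 1 + 1/(z_{k+1} - (n + 1)), while for n = a_{k+1} one has w_{i+1} = 1 + z_{k+2}, so
-- c_{i+1} = a_{k+2} + 2 ≥ 3 and w_{i+2} = 1 + 1/(z_{k+3} - 1). Along the way s_i/t_i is the
-- intermediate fraction (n p_k + p_{k-1})/(n q_k + q_{k-1}): for n = a_{k+1} it is p_{k+1}/q_{k+1},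
-- for n < a_{k+1} it is no ⌊ ⌋-convergent at all: D_l = X q_l - p_l Y obeys the continuant
-- recurrence, so D_l D_{l+1} is nondecreasing in l, and it is -n at l = k and a_{k+1} - n at
-- l = k + 1, hence D_l ≠ 0. As n reaches a_{k+1} after finitely many steps, ⌊ ⌋-convergents keep
-- occurring.
module Submission where

open import Defs
open import Data.Nat as ℕ using (ℕ; zero; suc; _∸_; z≤n; s≤s)
import Data.Nat.Properties as ℕP
open import Data.Nat.Coprimality using (1-coprimeTo) renaming (sym to coprime-sym)
open import Data.Integer as ℤ using (ℤ; +_; 0ℤ; 1ℤ)
import Data.Integer.Properties as ℤP
open import Data.Integer.Tactic.RingSolver using (solve-∀)
open import Data.Rational as ℚ using (ℚ; mkℚ; Positive; 0ℚ; 1ℚ)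
import Data.Rational.Properties as ℚP
open import Data.Rational.Solver using (module +-*-Solver)
open import Data.Product using (Σ; ∃; _×_; _,_; proj₁; proj₂)
open import Data.Sum using (_⊎_; inj₁; inj₂; [_,_]′)
open import Data.Empty using (⊥-elim)
open import Function.Base using (id; _∘_)
open import Function.Bundles using (_⇔_; mk⇔; Equivalence)
open import Function.Construct.Composition using (_⇔-∘_)
open import Function.Construct.Symmetry using (⇔-sym)
open import Relation.Binary.Definitions using (tri<; tri≈; tri>)
open import Relation.Binary.PropositionalEquality
open import Relation.Nullary using (¬_; yes; no)
open import Relation.Unary using (Decidable)
import Relation.Nullary.Decidable as Dec

open Equivalence using (to; from)

module _ where
  open import Data.Integer using (_+_; _*_; _-_; -_; _≤_; _<_)

  i<j⇒i≤j-1 : ∀ {i j} → i < j → i ≤ j - 1ℤ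
  i<j⇒i≤j-1 {i} {j} i<j = subst (i ≤_) (ℤP.+-comm ℤ.-1ℤ j) (ℤP.i<j⇒i≤pred[j] i<j)

  i+1-1≡i : ∀ i → i + 1ℤ - 1ℤ ≡ i
  i+1-1≡i = solve-∀

  i<j⇒i+1≤j : ∀ {i j} → i < j → i + 1ℤ ≤ j
  i<j⇒i+1≤j {i} {j} i<j = subst (_≤ j) (ℤP.+-comm 1ℤ i) (ℤP.i<j⇒suc[i]≤j i<j)

  nondecreasing⇒≤+ : ∀ (f : ℕ → ℤ) → (∀ m → f m ≤ f (suc m)) → ∀ d m → f m ≤ f (d ℕ.+ m)
  nondecreasing⇒≤+ f f↑ zero    m = ℤP.≤-refl
  nondecreasing⇒≤+ f f↑ (suc d) m = ℤP.≤-trans (nondecreasing⇒≤+ f f↑ d m) (f↑ (d ℕ.+ m))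

  nondecreasing-sign-change⇒≢0 : ∀ (f : ℕ → ℤ) k → (∀ m → f m ≤ f (suc m)) →
    f k < 0ℤ → 0ℤ < f (suc k) → ∀ l → f l ≢ 0ℤ
  nondecreasing-sign-change⇒≢0 f k f↑ fk<0 0<fk+1 l fl≡0 with l ℕ.≤? k
  ... | yes l≤k = ℤP.<-irrefl fl≡0 (ℤP.≤-<-trans fl≤fk fk<0)
    where
    fl≤fk : f l ≤ f k
    fl≤fk = subst (λ m → f l ≤ f m) (ℕP.m∸n+n≡m l≤k) (nondecreasing⇒≤+ f f↑ (k ∸ l) l)
  ... | no l≰k = ℤP.<-irrefl (sym fl≡0) (ℤP.<-≤-trans 0<fk+1 fk+1≤fl)
    where
    fk+1≤fl : f (suc k) ≤ f l
    fk+1≤fl = subst (λ m → f (suc k) ≤ f m) (ℕP.m∸n+n≡m (ℕP.≰⇒> l≰k))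
      (nondecreasing⇒≤+ f f↑ (l ∸ suc k) (suc k))

  i*i≥0 : ∀ i → 0ℤ ≤ i * i
  i*i≥0 i with ℤP.≤-total 0ℤ i
  ... | inj₁ 0≤i = ℤP.*-monoʳ-≤-nonNeg i {{ℤ.nonNegative 0≤i}} 0≤i
  ... | inj₂ i≤0 = ℤP.*-monoʳ-≤-nonPos i {{ℤ.nonPositive i≤0}} i≤0

  intermediate : (ℕ → ℤ) → ℕ → ℤ → ℤ
  intermediate X k n = n * X (suc k) + X k

  det : (ℕ → ℤ) → ℕ → ℤ
  det a m = P a m * Q a (suc m) - P a (suc m) * Q a m

  det-suc : ∀ a m → det a (suc m) ≡ - det a m
  det-suc a m = identity (a (suc m)) (P a (suc m)) (P a m) (Q a (suc m)) (Q a m)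
    where
    identity : ∀ A p₁ p₀ q₁ q₀ → p₁ * (A * q₁ + q₀) - (A * p₁ + p₀) * q₁ ≡ - (p₀ * q₁ - p₁ * q₀)
    identity = solve-∀

  det²≡1 : ∀ a m → det a m * det a m ≡ 1ℤ
  det²≡1 a zero = identity (a 0)
    where
    identity : ∀ x → (1ℤ * 1ℤ - x * 0ℤ) * (1ℤ * 1ℤ - x * 0ℤ) ≡ 1ℤ
    identity = solve-∀
  det²≡1 a (suc m) = begin
    det a (suc m) * det a (suc m)  ≡⟨ cong₂ _*_ (det-suc a m) (det-suc a m) ⟩
    - det a m * - det a m          ≡⟨ identity (det a m) ⟩
    det a m * det a m              ≡⟨ det²≡1 a m ⟩
    1ℤ                             ∎
    where
    open ≡-Reasoning
    identity : ∀ x → - x * - x ≡ x * x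
    identity = solve-∀

  cross : (ℕ → ℤ) → ℤ → ℤ → ℕ → ℤ
  cross a X Y l = X * Q a l - P a l * Y

  cross-product-nondecreasing : ∀ a X Y → (∀ m → + 1 ≤ a (suc m)) → ∀ l →
    cross a X Y l * cross a X Y (suc l) ≤ cross a X Y (suc l) * cross a X Y (suc (suc l))
  cross-product-nondecreasing a X Y a≥1 l =
    subst₂ _≤_ (ℤP.+-identityˡ (D l * D (suc l)))
      (sym (identity (a (suc l)) X Y (P a (suc l)) (P a l) (Q a (suc l)) (Q a l)))
      (ℤP.+-monoˡ-≤ (D l * D (suc l)) 0≤a*D²)
    where
    D = cross a X Y
    0≤a*D² : 0ℤ ≤ a (suc l) * (D (suc l) * D (suc l))
    0≤a*D² = subst (_≤ a (suc l) * (D (suc l) * D (suc l))) (ℤP.*-zeroʳ (a (suc l)))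
      (ℤP.*-monoˡ-≤-nonNeg (a (suc l)) {{ℤ.nonNegative (ℤP.≤-trans (ℤ.+≤+ z≤n) (a≥1 l))}} (i*i≥0 (D (suc l))))
    identity : ∀ A X Y p₁ p₀ q₁ q₀ → (X * q₁ - p₁ * Y) * (X * (A * q₁ + q₀) - (A * p₁ + p₀) * Y)
      ≡ A * ((X * q₁ - p₁ * Y) * (X * q₁ - p₁ * Y)) + (X * q₀ - p₀ * Y) * (X * q₁ - p₁ * Y)
    identity = solve-∀

  module _ (a : ℕ → ℤ) (k : ℕ) (n : ℤ) where
    private
      D = cross a (intermediate (P a) k n) (intermediate (Q a) k n)
      p₁ = P a (suc k)
      p₀ = P a k
      q₁ = Q a (suc k)
      q₀ = Q a k

      cancel-det² : ∀ {x} c → x ≡ c * (det a k * det a k) → x ≡ c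
      cancel-det² c x≡c*det² = trans x≡c*det² (trans (cong (c *_) (det²≡1 a k)) (ℤP.*-identityʳ c))

    cross-intermediate-k : D k * D (suc k) ≡ - n
    cross-intermediate-k = cancel-det² (- n) (identity n p₁ p₀ q₁ q₀)
      where
      identity : ∀ n p₁ p₀ q₁ q₀ →
        ((n * p₁ + p₀) * q₀ - p₀ * (n * q₁ + q₀)) * ((n * p₁ + p₀) * q₁ - p₁ * (n * q₁ + q₀))
          ≡ - n * ((p₀ * q₁ - p₁ * q₀) * (p₀ * q₁ - p₁ * q₀))
      identity = solve-∀

    cross-intermediate-suc-k : D (suc k) * D (suc (suc k)) ≡ a (suc k) - n
    cross-intermediate-suc-k = cancel-det² (a (suc k) - n) (identity n (a (suc k)) p₁ p₀ q₁ q₀)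
      where
      identity : ∀ n A p₁ p₀ q₁ q₀ →
        ((n * p₁ + p₀) * q₁ - p₁ * (n * q₁ + q₀))
          * ((n * p₁ + p₀) * (A * q₁ + q₀) - (A * p₁ + p₀) * (n * q₁ + q₀))
          ≡ (A - n) * ((p₀ * q₁ - p₁ * q₀) * (p₀ * q₁ - p₁ * q₀))
      identity = solve-∀

  intermediate-not-convergent : ∀ a → (∀ m → + 1 ≤ a (suc m)) → ∀ k n → + 1 ≤ n → n < a (suc k) →
    ∀ m → intermediate (P a) k n * Q a (suc m) ≢ P a (suc m) * intermediate (Q a) k n
  intermediate-not-convergent a a≥1 k n 1≤n n<a m X*q≡p*Y =
    nondecreasing-sign-change⇒≢0 (λ l → D l * D (suc l)) k (cross-product-nondecreasing a X Y a≥1)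
      Dk*Dk+1<0 0<Dk+1*Dk+2 (suc m) Dm+1*Dm+2≡0
    where
    X = intermediate (P a) k n
    Y = intermediate (Q a) k n
    D = cross a X Y
    Dk*Dk+1<0 : D k * D (suc k) < 0ℤ
    Dk*Dk+1<0 = subst (_< 0ℤ) (sym (cross-intermediate-k a k n))
      (ℤP.neg-mono-< (ℤP.<-≤-trans (ℤ.+<+ (s≤s z≤n)) 1≤n))
    0<Dk+1*Dk+2 : 0ℤ < D (suc k) * D (suc (suc k))
    0<Dk+1*Dk+2 = subst (0ℤ <_) (sym (cross-intermediate-suc-k a k n))
      (subst (_< a (suc k) - n) (ℤP.+-inverseʳ n) (ℤP.+-monoˡ-< (- n) n<a))
    Dm+1*Dm+2≡0 : D (suc m) * D (suc (suc m)) ≡ 0ℤ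
    Dm+1*Dm+2≡0 = begin
      (X * Q a (suc m) - pY) * D (suc (suc m))  ≡⟨ cong (λ x → (x - pY) * D (suc (suc m))) X*q≡p*Y ⟩
      (pY - pY) * D (suc (suc m))               ≡⟨ cong (_* D (suc (suc m))) (ℤP.+-inverseʳ pY) ⟩
      0ℤ * D (suc (suc m))                      ≡⟨ ℤP.*-zeroˡ (D (suc (suc m))) ⟩
      0ℤ                                        ∎
      where
      open ≡-Reasoning
      pY = P a (suc m) * Y

  record IsIntermediate (X : ℕ → ℤ) (k : ℕ) (n u₁ u₀ : ℤ) : Set where
    constructor isIntermediate
    field
      current  : u₁ ≡ intermediate X k n
      previous : u₀ ≡ intermediate X k (n - 1ℤ)

  IsIntermediate-suc : ∀ {X k n u₂ u₁ u₀} → IsIntermediate X k n u₁ u₀ → u₂ ≡ + 2 * u₁ - u₀ →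
    IsIntermediate X k (n + 1ℤ) u₂ u₁
  IsIntermediate-suc {X} {k} {n} (isIntermediate refl refl) refl =
    isIntermediate (identity₂ n (X (suc k)) (X k)) (identity₁ n (X (suc k)) (X k))
    where
    identity₂ : ∀ n x₁ x₀ → + 2 * (n * x₁ + x₀) - ((n - 1ℤ) * x₁ + x₀) ≡ (n + 1ℤ) * x₁ + x₀
    identity₂ = solve-∀
    identity₁ : ∀ n x₁ x₀ → n * x₁ + x₀ ≡ (n + 1ℤ - 1ℤ) * x₁ + x₀
    identity₁ = solve-∀

  IsIntermediate-shift : ∀ (a X : ℕ → ℤ) → (∀ m → X (suc (suc m)) ≡ a (suc m) * X (suc m) + X m) →
    ∀ {k u₂ u₁ u₀} → IsIntermediate X k (a (suc k)) u₁ u₀ → u₂ ≡ (a (suc (suc k)) + + 2) * u₁ - u₀ →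
    IsIntermediate X (suc (suc k)) (+ 1) u₂ u₁
  IsIntermediate-shift a X X-rec {k} (isIntermediate refl refl) refl = isIntermediate u₂≡ u₁≡
    where
    a₁ = a (suc k)
    a₂ = a (suc (suc k))
    x₁ = X (suc k)
    x₀ = X k
    X-rec² : X (suc (suc (suc k))) ≡ a₂ * (a₁ * x₁ + x₀) + x₁
    X-rec² = trans (X-rec (suc k)) (cong (λ y → a₂ * y + x₁) (X-rec k))
    u₂≡ : (a₂ + + 2) * intermediate X k a₁ - intermediate X k (a₁ - 1ℤ) ≡ intermediate X (suc (suc k)) (+ 1)
    u₂≡ = begin
      (a₂ + + 2) * (a₁ * x₁ + x₀) - ((a₁ - 1ℤ) * x₁ + x₀)  ≡⟨ identity a₁ a₂ x₁ x₀ ⟩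
      + 1 * (a₂ * (a₁ * x₁ + x₀) + x₁) + (a₁ * x₁ + x₀)   ≡⟨ cong₂ (λ y y′ → + 1 * y + y′) X-rec² (X-rec k) ⟨
      + 1 * X (suc (suc (suc k))) + X (suc (suc k))       ∎
      where
      open ≡-Reasoning
      identity : ∀ a₁ a₂ x₁ x₀ → (a₂ + + 2) * (a₁ * x₁ + x₀) - ((a₁ - 1ℤ) * x₁ + x₀)
        ≡ + 1 * (a₂ * (a₁ * x₁ + x₀) + x₁) + (a₁ * x₁ + x₀)
      identity = solve-∀
    u₁≡ : intermediate X k a₁ ≡ intermediate X (suc (suc k)) (+ 1 - 1ℤ)
    u₁≡ = trans (sym (X-rec k)) (sym (ℤP.+-identityˡ (X (suc (suc k)))))

module _ where
  open import Data.Rational using (_+_; _*_; _-_; -_; _≤_; _<_)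
  open +-*-Solver using (solve; _:=_; _:+_; _:*_; _:-_; con)

  -- ⟦ m ⟧ = m / 1 goes through a gcd computation that is stuck on variables; ⟦ m ⟧′ computes.
  ⟦_⟧′ : ℤ → ℚ
  ⟦ m ⟧′ = mkℚ m 0 (coprime-sym (1-coprimeTo ℤ.∣ m ∣))

  ⟦⟧≡⟦⟧′ : ∀ m → ⟦ m ⟧ ≡ ⟦ m ⟧′
  ⟦⟧≡⟦⟧′ m = ℚP.↥p/↧p≡p ⟦ m ⟧′

  ⟦⟧-homo-+ : ∀ m n → ⟦ m ℤ.+ n ⟧ ≡ ⟦ m ⟧ + ⟦ n ⟧
  ⟦⟧-homo-+ m n rewrite ⟦⟧≡⟦⟧′ m | ⟦⟧≡⟦⟧′ n =
    cong (ℚ._/ 1) (cong₂ ℤ._+_ (sym (ℤP.*-identityʳ m)) (sym (ℤP.*-identityʳ n)))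

  ⟦⟧-homo‿- : ∀ m → ⟦ ℤ.- m ⟧ ≡ - ⟦ m ⟧
  ⟦⟧-homo‿- m rewrite ⟦⟧≡⟦⟧′ m | ⟦⟧≡⟦⟧′ (ℤ.- m) = ⟦⟧′-homo‿- m
    where
    ⟦⟧′-homo‿- : ∀ m → ⟦ ℤ.- m ⟧′ ≡ - ⟦ m ⟧′
    ⟦⟧′-homo‿- (+ zero)   = refl
    ⟦⟧′-homo‿- ℤ.+[1+ n ] = refl
    ⟦⟧′-homo‿- ℤ.-[1+ n ] = refl

  ⟦⟧-homo-− : ∀ m n → ⟦ m ℤ.- n ⟧ ≡ ⟦ m ⟧ - ⟦ n ⟧
  ⟦⟧-homo-− m n = trans (⟦⟧-homo-+ m (ℤ.- n)) (cong (λ x → ⟦ m ⟧ + x) (⟦⟧-homo‿- n))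

  ⟦⟧-mono-≤ : ∀ {m n} → m ℤ.≤ n → ⟦ m ⟧ ≤ ⟦ n ⟧
  ⟦⟧-mono-≤ {m} {n} m≤n rewrite ⟦⟧≡⟦⟧′ m | ⟦⟧≡⟦⟧′ n =
    ℚ.*≤* (subst₂ ℤ._≤_ (sym (ℤP.*-identityʳ m)) (sym (ℤP.*-identityʳ n)) m≤n)

  <⇒≱ : ∀ {p q} → p < q → ¬ q ≤ p
  <⇒≱ p<q q≤p = ℚP.<-irrefl refl (ℚP.<-≤-trans p<q q≤p)

  ≰0⇒pos : ∀ {q} → ¬ q ≤ 0ℚ → Positive q
  ≰0⇒pos q≰0 = ℚ.positive (ℚP.≰⇒> q≰0)

  pos⇒≰0 : ∀ {q} → Positive q → ¬ q ≤ 0ℚ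
  pos⇒≰0 {q} q>0 q≤0 = <⇒≱ (ℚP.positive⁻¹ q {{q>0}}) q≤0

  p<q⇒pos[q-p] : ∀ {p q} → p < q → Positive (q - p)
  p<q⇒pos[q-p] {p} {q} p<q = ℚ.positive (subst (_< q - p) (ℚP.+-inverseʳ p) (ℚP.+-monoˡ-< (- p) p<q))

  p≤q⇒p-q≤0 : ∀ {p q} → p ≤ q → p - q ≤ 0ℚ
  p≤q⇒p-q≤0 {p} {q} p≤q = subst (p - q ≤_) (ℚP.+-inverseʳ q) (ℚP.+-monoˡ-≤ (- q) p≤q)

  p-q≤0⇒p≤q : ∀ {p q} → p - q ≤ 0ℚ → p ≤ q
  p-q≤0⇒p≤q {p} {q} p-q≤0 = subst₂ _≤_ p-q+q≡p (ℚP.+-identityˡ q) (ℚP.+-monoˡ-≤ q p-q≤0)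
    where
    p-q+q≡p : p - q + q ≡ p
    p-q+q≡p = solve 2 (λ p q → p :- q :+ q := p) refl p q

  recip⁺-inverseʳ : ∀ q (q>0 : Positive q) → q * recip⁺ q q>0 ≡ 1ℚ
  recip⁺-inverseʳ q q>0 = ℚP.*-inverseʳ q {{ℚP.pos⇒nonZero q {{q>0}}}}

  recip⁺-pos : ∀ q (q>0 : Positive q) → Positive (recip⁺ q q>0)
  recip⁺-pos q q>0 = ℚP.1/pos⇒pos q {{q>0}}

  -- recip⁺ q p does not depend on p (its NonZero instance is irrelevant), so proofs of positivity
  -- may be exchanged freely.
  recip⁺-cong : ∀ {p q} → p ≡ q → (p>0 : Positive p) (q>0 : Positive q) → recip⁺ p p>0 ≡ recip⁺ q q>0
  recip⁺-cong refl _ _ = refl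

  recip⁺-unique : ∀ q (q>0 : Positive q) x → x * q ≡ 1ℚ → recip⁺ q q>0 ≡ x
  recip⁺-unique q q>0 x xq≡1 = begin
    r            ≡⟨ sym (ℚP.*-identityˡ r) ⟩
    1ℚ * r       ≡⟨ cong (_* r) (sym xq≡1) ⟩
    (x * q) * r  ≡⟨ ℚP.*-assoc x q r ⟩
    x * (q * r)  ≡⟨ cong (x *_) (recip⁺-inverseʳ q q>0) ⟩
    x * 1ℚ       ≡⟨ ℚP.*-identityʳ x ⟩
    x            ∎
    where
    open ≡-Reasoning
    r = recip⁺ q q>0

  recip⁺-antimono-≤ : ∀ {p q} (p>0 : Positive p) (q>0 : Positive q) → p ≤ q → recip⁺ q q>0 ≤ recip⁺ p p>0
  recip⁺-antimono-≤ {p} {q} p>0 q>0 p≤q = begin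
    rq             ≡⟨ sym (ℚP.*-identityʳ rq) ⟩
    rq * 1ℚ        ≡⟨ cong (rq *_) (sym (recip⁺-inverseʳ p p>0)) ⟩
    rq * (p * rp)  ≡⟨ sym (ℚP.*-assoc rq p rp) ⟩
    (rq * p) * rp  ≤⟨ ℚP.*-monoʳ-≤-nonNeg rp {{ℚP.pos⇒nonNeg rp {{recip⁺-pos p p>0}}}}
                        (ℚP.*-monoˡ-≤-nonNeg rq {{ℚP.pos⇒nonNeg rq {{recip⁺-pos q q>0}}}} p≤q) ⟩
    (rq * q) * rp  ≡⟨ cong (_* rp) (trans (ℚP.*-comm rq q) (recip⁺-inverseʳ q q>0)) ⟩
    1ℚ * rp        ≡⟨ ℚP.*-identityˡ rp ⟩
    rp             ∎
    where
    open ℚP.≤-Reasoning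
    rq = recip⁺ q q>0
    rp = recip⁺ p p>0

  recip⁺-≥1 : ∀ q (q>0 : Positive q) → q ≤ 1ℚ → 1ℚ ≤ recip⁺ q q>0
  recip⁺-≥1 q q>0 q≤1 = recip⁺-antimono-≤ q>0 _ q≤1

  recip⁺-<1 : ∀ q (q>0 : Positive q) → 1ℚ < q → recip⁺ q q>0 < 1ℚ
  recip⁺-<1 q q>0 1<q = subst₂ _<_ (ℚP.*-identityˡ r) (recip⁺-inverseʳ q q>0)
    (ℚP.*-monoˡ-<-pos r {{recip⁺-pos q q>0}} 1<q)
    where r = recip⁺ q q>0

  1+recip⁺[q-1]*1-recip⁺[q]≡1 : ∀ q (q>0 : Positive q) (q-1>0 : Positive (q - 1ℚ)) →
    (1ℚ + recip⁺ (q - 1ℚ) q-1>0) * (1ℚ - recip⁺ q q>0) ≡ 1ℚ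
  1+recip⁺[q-1]*1-recip⁺[q]≡1 q q>0 q-1>0 = begin
    (1ℚ + u) * (1ℚ - v)                                ≡⟨ expand u v q ⟩
    1ℚ + u * (1ℚ - q * v) - v * (1ℚ - (q - 1ℚ) * u)    ≡⟨ cong₂ (λ x y → 1ℚ + u * (1ℚ - x) - v * (1ℚ - y))
                                                             (recip⁺-inverseʳ q q>0) (recip⁺-inverseʳ (q - 1ℚ) q-1>0) ⟩
    1ℚ + u * (1ℚ - 1ℚ) - v * (1ℚ - 1ℚ)                  ≡⟨ collapse u v ⟩
    1ℚ                                                 ∎
    where
    open ≡-Reasoning
    u = recip⁺ (q - 1ℚ) q-1>0
    v = recip⁺ q q>0
    expand : ∀ u v q → (1ℚ + u) * (1ℚ - v) ≡ 1ℚ + u * (1ℚ - q * v) - v * (1ℚ - (q - 1ℚ) * u)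
    expand = solve 3 (λ u v q → (con 1ℚ :+ u) :* (con 1ℚ :- v)
                                := con 1ℚ :+ u :* (con 1ℚ :- q :* v) :- v :* (con 1ℚ :- (q :- con 1ℚ) :* u)) refl
    collapse : ∀ u v → 1ℚ + u * (1ℚ - 1ℚ) - v * (1ℚ - 1ℚ) ≡ 1ℚ
    collapse = solve 2 (λ u v → con 1ℚ :+ u :* (con 1ℚ :- con 1ℚ) :- v :* (con 1ℚ :- con 1ℚ) := con 1ℚ) refl

  recip⁺[1+recip⁺[q-1]] : ∀ q (q>0 : Positive q) (q-1>0 : Positive (q - 1ℚ)) r>0 →
    recip⁺ (1ℚ + recip⁺ (q - 1ℚ) q-1>0) r>0 ≡ 1ℚ - recip⁺ q q>0
  recip⁺[1+recip⁺[q-1]] q q>0 q-1>0 r>0 = recip⁺-unique _ r>0 _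
    (trans (ℚP.*-comm (1ℚ - recip⁺ q q>0) _) (1+recip⁺[q-1]*1-recip⁺[q]≡1 q q>0 q-1>0))

  recip⁺[1-recip⁺[q]] : ∀ q (q>0 : Positive q) (q-1>0 : Positive (q - 1ℚ)) r>0 →
    recip⁺ (1ℚ - recip⁺ q q>0) r>0 ≡ 1ℚ + recip⁺ (q - 1ℚ) q-1>0
  recip⁺[1-recip⁺[q]] q q>0 q-1>0 r>0 = recip⁺-unique _ r>0 _ (1+recip⁺[q-1]*1-recip⁺[q]≡1 q q>0 q-1>0)

  DownClosed : Cut → Set
  DownClosed L = ∀ p q → p ≤ q → L q → L p

  cut-cong : (L : Cut) {p q : ℚ} → p ≡ q → L p ⇔ L q
  cut-cong L refl = mk⇔ id id

  RegStep-downClosed : ∀ {L L′} a → DownClosed L → RegStep L a L′ → DownClosed L′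
  RegStep-downClosed {L} a L↓ step p q p≤q L′q with to (step q) L′q | p ℚ.≤? 0ℚ
  ... | _ | yes p≤0 = from (step p) (inj₁ p≤0)
  ... | inj₁ q≤0 | no p≰0 = ⊥-elim (p≰0 (ℚP.≤-trans p≤q q≤0))
  ... | inj₂ (q>0 , ¬L[a+1/q]) | no p≰0 = from (step p) (inj₂ (p>0 , λ L[a+1/p] →
          ¬L[a+1/q] (L↓ _ _ (ℚP.+-monoʳ-≤ ⟦ a ⟧ (recip⁺-antimono-≤ p>0 q>0 p≤q)) L[a+1/p])))
    where p>0 = ≰0⇒pos p≰0

  NegStep-downClosed : ∀ {L L′} c → DownClosed L → NegStep L c L′ → DownClosed L′
  NegStep-downClosed {L} c L↓ step p q p≤q L′q with to (step q) L′q | p ℚ.≤? 0ℚ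
  ... | _ | yes p≤0 = from (step p) (inj₁ p≤0)
  ... | inj₁ q≤0 | no p≰0 = ⊥-elim (p≰0 (ℚP.≤-trans p≤q q≤0))
  ... | inj₂ (q>0 , L[c-1/q]) | no p≰0 = from (step p) (inj₂ (p>0 ,
          L↓ _ _ (ℚP.+-monoʳ-≤ ⟦ c ⟧ (ℚP.neg-antimono-≤ (recip⁺-antimono-≤ p>0 q>0 p≤q))) L[c-1/q]))
    where p>0 = ≰0⇒pos p≰0

  RegStep-decidable : ∀ {L L′} a → Decidable L → RegStep L a L′ → Decidable L′
  RegStep-decidable {L} a L? step q with q ℚ.≤? 0ℚ
  ... | yes q≤0 = yes (from (step q) (inj₁ q≤0))
  ... | no q≰0 with L? (⟦ a ⟧ + recip⁺ q (≰0⇒pos q≰0))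
  ...   | yes L[a+1/q] = no λ L′q → [ q≰0 , (λ (_ , ¬L[a+1/q]) → ¬L[a+1/q] L[a+1/q]) ]′ (to (step q) L′q)
  ...   | no ¬L[a+1/q] = yes (from (step q) (inj₂ (≰0⇒pos q≰0 , ¬L[a+1/q])))

  RegStep-¬ : ∀ {L a L′} → Decidable L → RegStep L a L′ →
    ∀ r (r>0 : Positive r) → (¬ L′ r) ⇔ L (⟦ a ⟧ + recip⁺ r r>0)
  RegStep-¬ {L} {a} {L′} L? step r r>0 = mk⇔ ¬L′r⇒L L⇒¬L′r
    where
    ¬L′r⇒L : ¬ L′ r → L (⟦ a ⟧ + recip⁺ r r>0)
    ¬L′r⇒L ¬L′r with L? (⟦ a ⟧ + recip⁺ r r>0)
    ... | yes L[a+1/r] = L[a+1/r]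
    ... | no ¬L[a+1/r] = ⊥-elim (¬L′r (from (step r) (inj₂ (r>0 , ¬L[a+1/r]))))
    L⇒¬L′r : L (⟦ a ⟧ + recip⁺ r r>0) → ¬ L′ r
    L⇒¬L′r L[a+1/r] L′r = [ pos⇒≰0 r>0 , (λ (_ , ¬L[a+1/r]) → ¬L[a+1/r] L[a+1/r]) ]′ (to (step r) L′r)

  IsCeil-unique : ∀ {W c c′} → DownClosed W → IsCeil W c → IsCeil W c′ → c ≡ c′
  IsCeil-unique {W} {c} {c′} W↓ (W[c-1] , ¬W[c]) (W[c′-1] , ¬W[c′]) with ℤP.<-cmp c c′
  ... | tri≈ _ c≡c′ _ = c≡c′
  ... | tri< c<c′ _ _ = ⊥-elim (¬W[c] (W↓ _ _ (⟦⟧-mono-≤ (i<j⇒i≤j-1 c<c′)) W[c′-1]))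
  ... | tri> _ _ c′<c = ⊥-elim (¬W[c′] (W↓ _ _ (⟦⟧-mono-≤ (i<j⇒i≤j-1 c′<c)) W[c-1]))

  RegStep-floor≥1 : ∀ {L L′} a a′ → IsFloor L a → RegStep L a L′ → DownClosed L′ → IsFloor L′ a′ → + 1 ℤ.≤ a′
  RegStep-floor≥1 {L} {L′} a a′ (_ , ¬L[a+1]) step L′↓ (_ , ¬L′[a′+1]) with + 1 ℤ.≤? a′
  ... | yes 1≤a′ = 1≤a′
  ... | no 1≰a′ = ⊥-elim (¬L′[a′+1] (L′↓ _ _ (⟦⟧-mono-≤ (i<j⇒i+1≤j (ℤP.≰⇒> 1≰a′))) L′[1]))
    where
    L′[1] : L′ 1ℚ
    L′[1] = from (step 1ℚ) (inj₂ (_ , λ L[a+1] → ¬L[a+1] (subst L (sym (⟦⟧-homo-+ a 1ℤ)) L[a+1])))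

  -- The cut of 1 + 1/(ζ - n), where Z is the cut of ζ > n.
  onePlusRecip : Cut → ℤ → Cut
  onePlusRecip Z n q = q ≤ 1ℚ ⊎ Σ (Positive (q - 1ℚ)) λ q-1>0 → ¬ Z (⟦ n ⟧ + recip⁺ (q - 1ℚ) q-1>0)

  OnePlusRecip : Cut → Cut → ℤ → Set
  OnePlusRecip W Z n = ∀ q → W q ⇔ onePlusRecip Z n q

  -- W is the cut of ζ + (c - a - 1), where Z is the cut of ζ.
  Translate : Cut → ℤ → Cut → ℤ → Set
  Translate W c Z a = ∀ x → W (⟦ c ⟧ - x) ⇔ Z (⟦ a ⟧ + (1ℚ - x))

  1<2 : 1ℚ < ⟦ + 2 ⟧
  1<2 = ℚ.*<* (ℤ.+<+ (s≤s (s≤s z≤n)))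

  OnePlusRecip-ceil≡2 : ∀ {W Z} a n → DownClosed Z → IsFloor Z a → n ℤ.+ 1ℤ ℤ.≤ a →
    OnePlusRecip W Z n → IsCeil W (+ 2)
  OnePlusRecip-ceil≡2 {W} {Z} a n Z↓ (Z[a] , _) n+1≤a W≡ = from (W≡ 1ℚ) (inj₁ ℚP.≤-refl) , ¬W[2]
    where
    ¬W[2] : ¬ W ⟦ + 2 ⟧
    ¬W[2] W[2] with to (W≡ _) W[2]
    ... | inj₁ 2≤1 = <⇒≱ 1<2 2≤1
    ... | inj₂ (_ , ¬Z[n+1]) = ¬Z[n+1] (subst Z (⟦⟧-homo-+ n 1ℤ) (Z↓ _ _ (⟦⟧-mono-≤ n+1≤a) Z[a]))

  1<q⇒pos : ∀ {q} → 1ℚ < q → Positive q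
  1<q⇒pos 1<q = ℚ.positive (ℚP.<-trans (ℚP.positive⁻¹ 1ℚ) 1<q)

  -- Below 1 both cuts hold (c - 1 < w gives 1/(c - w) > 1); only q > 1 needs information on W.
  NegStep-OnePlusRecip : ∀ {W c W′ Z′ n} → DownClosed W → IsCeil W c → NegStep W c W′ →
    (∀ q (1<q : 1ℚ < q) →
       W (⟦ c ⟧ - recip⁺ q (1<q⇒pos 1<q)) ⇔ (¬ Z′ (⟦ n ⟧ + recip⁺ (q - 1ℚ) (p<q⇒pos[q-p] 1<q)))) →
    OnePlusRecip W′ Z′ n
  NegStep-OnePlusRecip {W} {c} {W′} {Z′} {n} W↓ (W[c-1] , _) step W≡ q with q ℚ.≤? 0ℚ
  ... | yes q≤0 = mk⇔ (λ _ → inj₁ (ℚP.≤-trans q≤0 (ℚP.<⇒≤ (ℚP.positive⁻¹ 1ℚ))))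
                      (λ _ → from (step q) (inj₁ q≤0))
  ... | no q≰0 with q ℚ.≤? 1ℚ
  ...   | yes q≤1 = mk⇔ (λ _ → inj₁ q≤1) (λ _ → from (step q) (inj₂ (q>0 , W↓ _ _ c-1/q≤c-1 W[c-1])))
    where
    q>0 = ≰0⇒pos q≰0
    c-1/q≤c-1 : ⟦ c ⟧ - recip⁺ q q>0 ≤ ⟦ c ℤ.- 1ℤ ⟧
    c-1/q≤c-1 = subst (⟦ c ⟧ - recip⁺ q q>0 ≤_) (sym (⟦⟧-homo-− c 1ℤ))
      (ℚP.+-monoʳ-≤ ⟦ c ⟧ (ℚP.neg-antimono-≤ (recip⁺-≥1 q q>0 q≤1)))
  ...   | no q≰1 = mk⇔ W′q⇒ ⇒W′q
    where
    1<q = ℚP.≰⇒> q≰1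
    W′q⇒ : W′ q → onePlusRecip Z′ n q
    W′q⇒ W′q with to (step q) W′q
    ... | inj₁ q≤0 = ⊥-elim (q≰0 q≤0)
    ... | inj₂ (_ , W[c-1/q]) = inj₂ (p<q⇒pos[q-p] 1<q , to (W≡ q 1<q) W[c-1/q])
    ⇒W′q : onePlusRecip Z′ n q → W′ q
    ⇒W′q (inj₁ q≤1) = ⊥-elim (q≰1 q≤1)
    ⇒W′q (inj₂ (_ , ¬Z′)) = from (step q) (inj₂ (1<q⇒pos 1<q , from (W≡ q 1<q) ¬Z′))

  OnePlusRecip-NegStep-2 : ∀ {W W′ Z} n → DownClosed W → IsCeil W (+ 2) → NegStep W (+ 2) W′ →
    OnePlusRecip W Z n → OnePlusRecip W′ Z (n ℤ.+ 1ℤ)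
  OnePlusRecip-NegStep-2 {W} {W′} {Z} n W↓ W⌈2⌉ step W≡ =
    NegStep-OnePlusRecip {c = + 2} {Z′ = Z} {n = n ℤ.+ 1ℤ} W↓ W⌈2⌉ step W[2-1/q]
    where
    W[2-1/q] : ∀ q (1<q : 1ℚ < q) →
      W (⟦ + 2 ⟧ - recip⁺ q (1<q⇒pos 1<q)) ⇔ (¬ Z (⟦ n ℤ.+ 1ℤ ⟧ + recip⁺ (q - 1ℚ) (p<q⇒pos[q-p] 1<q)))
    W[2-1/q] q 1<q = mk⇔ W[x]⇒ ⇒W[x]
      where
      q>0 = 1<q⇒pos 1<q
      q-1>0 = p<q⇒pos[q-p] 1<q
      v = recip⁺ q q>0
      u = recip⁺ (q - 1ℚ) q-1>0
      x = ⟦ + 2 ⟧ - v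
      x-1≡1-v : x - 1ℚ ≡ 1ℚ - v
      x-1≡1-v = solve 1 (λ v → (con 1ℚ :+ con 1ℚ) :- v :- con 1ℚ := con 1ℚ :- v) refl v
      1-v>0 : Positive (1ℚ - v)
      1-v>0 = p<q⇒pos[q-p] (recip⁺-<1 q q>0 1<q)
      x-1>0 : Positive (x - 1ℚ)
      x-1>0 = subst Positive (sym x-1≡1-v) 1-v>0
      n+1+u≡n+1/[x-1] : (x-1>0′ : Positive (x - 1ℚ)) → ⟦ n ℤ.+ 1ℤ ⟧ + u ≡ ⟦ n ⟧ + recip⁺ (x - 1ℚ) x-1>0′
      n+1+u≡n+1/[x-1] x-1>0′ = begin
        ⟦ n ℤ.+ 1ℤ ⟧ + u                ≡⟨ cong (_+ u) (⟦⟧-homo-+ n 1ℤ) ⟩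
        ⟦ n ⟧ + 1ℚ + u                  ≡⟨ ℚP.+-assoc ⟦ n ⟧ 1ℚ u ⟩
        ⟦ n ⟧ + (1ℚ + u)                ≡⟨ cong (λ y → ⟦ n ⟧ + y) (recip⁺[1-recip⁺[q]] q q>0 q-1>0 1-v>0) ⟨
        ⟦ n ⟧ + recip⁺ (1ℚ - v) 1-v>0   ≡⟨ cong (λ y → ⟦ n ⟧ + y) (recip⁺-cong (sym x-1≡1-v) 1-v>0 x-1>0′) ⟩
        ⟦ n ⟧ + recip⁺ (x - 1ℚ) x-1>0′  ∎
        where open ≡-Reasoning
      W[x]⇒ : W x → ¬ Z (⟦ n ℤ.+ 1ℤ ⟧ + u)
      W[x]⇒ W[x] with to (W≡ x) W[x]
      ... | inj₁ x≤1 = ⊥-elim (pos⇒≰0 x-1>0 (p≤q⇒p-q≤0 x≤1))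
      ... | inj₂ (x-1>0′ , ¬Z[n+1/[x-1]]) =
        λ Z[n+1+u] → ¬Z[n+1/[x-1]] (subst Z (n+1+u≡n+1/[x-1] x-1>0′) Z[n+1+u])
      ⇒W[x] : ¬ Z (⟦ n ℤ.+ 1ℤ ⟧ + u) → W x
      ⇒W[x] ¬Z[n+1+u] = from (W≡ x) (inj₂ (x-1>0 , λ Z[n+1/[x-1]] →
        ¬Z[n+1+u] (subst Z (sym (n+1+u≡n+1/[x-1] x-1>0)) Z[n+1/[x-1]])))

  Translate-NegStep : ∀ {W W′ Z Z′} c a → DownClosed W → IsCeil W c → NegStep W c W′ →
    Decidable Z → RegStep Z a Z′ → Translate W c Z a → OnePlusRecip W′ Z′ (+ 1)
  Translate-NegStep {W} {W′} {Z} {Z′} c a W↓ W⌈c⌉ step Z? Z-step W≡ =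
    NegStep-OnePlusRecip {c = c} {Z′ = Z′} {n = + 1} W↓ W⌈c⌉ step W[c-1/q]
    where
    W[c-1/q] : ∀ q (1<q : 1ℚ < q) →
      W (⟦ c ⟧ - recip⁺ q (1<q⇒pos 1<q)) ⇔ (¬ Z′ (1ℚ + recip⁺ (q - 1ℚ) (p<q⇒pos[q-p] 1<q)))
    W[c-1/q] q 1<q = ⇔-sym (RegStep-¬ {a = a} Z? Z-step r r>0) ⇔-∘ (cut-cong Z a+1-v≡a+1/r ⇔-∘ W≡ v)
      where
      v = recip⁺ q (1<q⇒pos 1<q)
      q-1>0 = p<q⇒pos[q-p] 1<q
      u = recip⁺ (q - 1ℚ) q-1>0
      r = 1ℚ + u
      r>0 : Positive r
      r>0 = ℚP.pos+pos⇒pos 1ℚ u {{recip⁺-pos (q - 1ℚ) q-1>0}}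
      a+1-v≡a+1/r : ⟦ a ⟧ + (1ℚ - v) ≡ ⟦ a ⟧ + recip⁺ r r>0
      a+1-v≡a+1/r = cong (λ y → ⟦ a ⟧ + y) (sym (recip⁺[1+recip⁺[q-1]] q (1<q⇒pos 1<q) q-1>0 r>0))

  ⟦m+1⟧-1≡⟦m⟧ : ∀ m → ⟦ m ℤ.+ 1ℤ ⟧ - 1ℚ ≡ ⟦ m ⟧
  ⟦m+1⟧-1≡⟦m⟧ m = trans (cong (_- 1ℚ) (⟦⟧-homo-+ m 1ℤ))
    (solve 1 (λ x → x :+ con 1ℚ :- con 1ℚ := x) refl ⟦ m ⟧)

  OnePlusRecip-RegStep : ∀ {W Z Z′} a → OnePlusRecip W Z a → RegStep Z a Z′ → ∀ q → W q ⇔ Z′ (q - 1ℚ)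
  OnePlusRecip-RegStep {W} {Z} {Z′} a W≡ Z-step q = mk⇔ W[q]⇒ ⇒W[q]
    where
    W[q]⇒ : W q → Z′ (q - 1ℚ)
    W[q]⇒ W[q] with to (W≡ q) W[q]
    ... | inj₁ q≤1 = from (Z-step _) (inj₁ (p≤q⇒p-q≤0 q≤1))
    ... | inj₂ (q-1>0 , ¬Z) = from (Z-step _) (inj₂ (q-1>0 , ¬Z))
    ⇒W[q] : Z′ (q - 1ℚ) → W q
    ⇒W[q] Z′[q-1] with to (Z-step _) Z′[q-1]
    ... | inj₁ q-1≤0 = from (W≡ q) (inj₁ (p-q≤0⇒p≤q q-1≤0))
    ... | inj₂ (q-1>0 , ¬Z) = from (W≡ q) (inj₂ (q-1>0 , ¬Z))

  shifted-ceil : ∀ {W Z} a → (∀ q → W q ⇔ Z (q - 1ℚ)) → IsFloor Z a → IsCeil W (a ℤ.+ + 2)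
  shifted-ceil {W} {Z} a W≡ (Z[a] , ¬Z[a+1]) =
    from (W≡ _) (subst Z (sym a+2-1-1≡a) Z[a]) , λ W[a+2] → ¬Z[a+1] (subst Z a+2-1≡a+1 (to (W≡ _) W[a+2]))
    where
    a+2-1≡a+1 : ⟦ a ℤ.+ + 2 ⟧ - 1ℚ ≡ ⟦ a ℤ.+ 1ℤ ⟧
    a+2-1≡a+1 = trans (cong (λ m → ⟦ m ⟧ - 1ℚ) (sym (ℤP.+-assoc a 1ℤ 1ℤ))) (⟦m+1⟧-1≡⟦m⟧ (a ℤ.+ 1ℤ))
    a+2-1-1≡a : ⟦ a ℤ.+ + 2 ℤ.- 1ℤ ⟧ - 1ℚ ≡ ⟦ a ⟧
    a+2-1-1≡a = trans (cong (λ m → ⟦ m ⟧ - 1ℚ) (m+2-1≡m+1 a)) (⟦m+1⟧-1≡⟦m⟧ a)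
      where
      m+2-1≡m+1 : ∀ m → m ℤ.+ + 2 ℤ.- 1ℤ ≡ m ℤ.+ 1ℤ
      m+2-1≡m+1 = solve-∀

  shifted-translate : ∀ {W Z} a → (∀ q → W q ⇔ Z (q - 1ℚ)) → Translate W (a ℤ.+ + 2) Z a
  shifted-translate {W} {Z} a W≡ x = cut-cong Z a+2-x-1≡a+[1-x] ⇔-∘ W≡ (⟦ a ℤ.+ + 2 ⟧ - x)
    where
    a+2-x-1≡a+[1-x] : ⟦ a ℤ.+ + 2 ⟧ - x - 1ℚ ≡ ⟦ a ⟧ + (1ℚ - x)
    a+2-x-1≡a+[1-x] = trans (cong (λ y → y - x - 1ℚ) (⟦⟧-homo-+ a (+ 2)))
      (solve 2 (λ y x → y :+ (con 1ℚ :+ con 1ℚ) :- x :- con 1ℚ := y :+ (con 1ℚ :- x)) refl ⟦ a ⟧ x)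

open import Data.Nat using (_≤_)

module Expansions
  (z : Irrational) (a c : ℕ → ℤ)
  (zs : ℕ → Cut) (zs₀ : ∀ q → zs zero q ⇔ lower z q)
  (⌊zs⌋ : ∀ j → IsFloor (zs j) (a j)) (zs-step : ∀ j → RegStep (zs j) (a j) (zs (suc j)))
  (ws : ℕ → Cut) (ws₀ : ∀ q → ws zero q ⇔ lower z q)
  (⌈ws⌉ : ∀ j → IsCeil (ws j) (c j)) (ws-step : ∀ j → NegStep (ws j) (c j) (ws (suc j)))
  where

  open import Data.Integer using (_+_; _*_; _-_)

  zs-downClosed : ∀ k → DownClosed (zs k)
  zs-downClosed zero p q p≤q zs₀[q] = from (zs₀ p) (down-closed z p q p≤q (to (zs₀ q) zs₀[q]))
  zs-downClosed (suc k) = RegStep-downClosed (a k) (zs-downClosed k) (zs-step k)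

  ws-downClosed : ∀ i → DownClosed (ws i)
  ws-downClosed zero p q p≤q ws₀[q] = from (ws₀ p) (down-closed z p q p≤q (to (ws₀ q) ws₀[q]))
  ws-downClosed (suc i) = NegStep-downClosed (c i) (ws-downClosed i) (ws-step i)

  zs-decidable : ∀ k → Decidable (zs k)
  zs-decidable zero q = Dec.map (⇔-sym (zs₀ q)) (lower? z q)
  zs-decidable (suc k) = RegStep-decidable (a k) (zs-decidable k) (zs-step k)

  a≥1 : ∀ k → + 1 ℤ.≤ a (suc k)
  a≥1 k = RegStep-floor≥1 {L = zs k} (a k) (a (suc k))
    (⌊zs⌋ k) (zs-step k) (zs-downClosed (suc k)) (⌊zs⌋ (suc k))

  ceil⇒c≡ : ∀ {i d} → IsCeil (ws i) d → c i ≡ d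
  ceil⇒c≡ {i} = IsCeil-unique (ws-downClosed i) (⌈ws⌉ i)

  -- s_i/t_i is the intermediate fraction (n p_k + p_{k-1})/(n q_k + q_{k-1}),
  -- and w_{i+1} = 1 + 1/(z_{k+1} - n).
  record Mediant (i : ℕ) : Set where
    field
      k : ℕ
      n : ℤ
      1≤n : + 1 ℤ.≤ n
      n≤a : n ℤ.≤ a (suc k)
      ws≡ : OnePlusRecip (ws (suc i)) (zs (suc k)) n
      num : IsIntermediate (P a) k n (S c (suc i)) (S c i)
      den : IsIntermediate (Q a) k n (T c (suc i)) (T c i)

  mediant₀ : Mediant 0
  mediant₀ = record
    { k = 0 ; n = + 1 ; 1≤n = ℤP.≤-refl ; n≤a = a≥1 0
    ; ws≡ = Translate-NegStep (c 0) (a 0) (ws-downClosed 0) (⌈ws⌉ 0) (ws-step 0)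
              (zs-decidable 0) (zs-step 0) ws₀-translate
    ; num = isIntermediate (trans c₀≡a₀+1 (cong (_+ 1ℤ) (sym (ℤP.*-identityˡ (a 0))))) refl
    ; den = isIntermediate refl refl
    }
    where
    ws₀≡zs₀ : ∀ q → ws 0 q ⇔ zs 0 q
    ws₀≡zs₀ q = ⇔-sym (zs₀ q) ⇔-∘ ws₀ q
    c₀≡a₀+1 : c 0 ≡ a 0 + 1ℤ
    c₀≡a₀+1 = ceil⇒c≡
      ( from (ws₀≡zs₀ _) (subst (zs 0) (cong ⟦_⟧ (sym (i+1-1≡i (a 0)))) (proj₁ (⌊zs⌋ 0)))
      , λ ws₀[a₀+1] → proj₂ (⌊zs⌋ 0) (to (ws₀≡zs₀ _) ws₀[a₀+1]))
    ws₀-translate : Translate (ws 0) (c 0) (zs 0) (a 0)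
    ws₀-translate x rewrite c₀≡a₀+1 = cut-cong (zs 0) a₀+1-x≡a₀+[1-x] ⇔-∘ ws₀≡zs₀ _
      where
      a₀+1-x≡a₀+[1-x] : ⟦ a 0 + 1ℤ ⟧ ℚ.- x ≡ ⟦ a 0 ⟧ ℚ.+ (1ℚ ℚ.- x)
      a₀+1-x≡a₀+[1-x] = trans (cong (ℚ._- x) (⟦⟧-homo-+ (a 0) 1ℤ)) (ℚP.+-assoc ⟦ a 0 ⟧ 1ℚ (ℚ.- x))

  module _ {i} (M : Mediant i) where
    open Mediant M

    c≡2 : n ℤ.< a (suc k) → c (suc i) ≡ + 2
    c≡2 n<a = ceil⇒c≡
      (OnePlusRecip-ceil≡2 (a (suc k)) n (zs-downClosed (suc k)) (⌊zs⌋ (suc k)) (i<j⇒i+1≤j n<a) ws≡)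

    next-intermediate : n ℤ.< a (suc k) → Mediant (suc i)
    next-intermediate n<a = record
      { k = k ; n = n + 1ℤ
      ; 1≤n = ℤP.≤-trans 1≤n (ℤP.i≤i+j n 1ℤ) ; n≤a = i<j⇒i+1≤j n<a
      ; ws≡ = OnePlusRecip-NegStep-2 {Z = zs (suc k)} n (ws-downClosed (suc i))
                (subst (IsCeil (ws (suc i))) (c≡2 n<a) (⌈ws⌉ (suc i)))
                (subst (λ d → NegStep (ws (suc i)) d (ws (suc (suc i)))) (c≡2 n<a) (ws-step (suc i))) ws≡
      ; num = IsIntermediate-suc num (cong (λ d → d * S c (suc i) - S c i) (c≡2 n<a))
      ; den = IsIntermediate-suc den (cong (λ d → d * T c (suc i) - T c i) (c≡2 n<a))
      }

    ws≡zs+1 : n ≡ a (suc k) → ∀ q → ws (suc i) q ⇔ zs (suc (suc k)) (q ℚ.- 1ℚ)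
    ws≡zs+1 n≡a = OnePlusRecip-RegStep {Z = zs (suc k)} (a (suc k))
      (subst (OnePlusRecip (ws (suc i)) (zs (suc k))) n≡a ws≡) (zs-step (suc k))

    c≡a+2 : n ≡ a (suc k) → c (suc i) ≡ a (suc (suc k)) + + 2
    c≡a+2 n≡a = ceil⇒c≡
      (shifted-ceil {Z = zs (suc (suc k))} (a (suc (suc k))) (ws≡zs+1 n≡a) (⌊zs⌋ (suc (suc k))))

    next-convergent : n ≡ a (suc k) → Mediant (suc i)
    next-convergent n≡a = record
      { k = suc (suc k) ; n = + 1 ; 1≤n = ℤP.≤-refl ; n≤a = a≥1 (suc (suc k))
      ; ws≡ = Translate-NegStep (c (suc i)) (a (suc (suc k)))
                (ws-downClosed (suc i)) (⌈ws⌉ (suc i)) (ws-step (suc i))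
                (zs-decidable (suc (suc k))) (zs-step (suc (suc k)))
                (subst (λ d → Translate (ws (suc i)) d (zs (suc (suc k))) (a (suc (suc k))))
                  (sym (c≡a+2 n≡a)) (shifted-translate {Z = zs (suc (suc k))} (a (suc (suc k))) (ws≡zs+1 n≡a)))
      ; num = IsIntermediate-shift a (P a) (λ _ → refl) {k = k}
                (subst (λ n → IsIntermediate (P a) k n (S c (suc i)) (S c i)) n≡a num)
                (cong (λ d → d * S c (suc i) - S c i) (c≡a+2 n≡a))
      ; den = IsIntermediate-shift a (Q a) (λ _ → refl) {k = k}
                (subst (λ n → IsIntermediate (Q a) k n (T c (suc i)) (T c i)) n≡a den)
                (cong (λ d → d * T c (suc i) - T c i) (c≡a+2 n≡a))
      }

    convergent : n ≡ a (suc k) → IsRegConvergent a (S c (suc i)) (T c (suc i))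
    convergent n≡a = suc k , subst₂ (λ s t → s * Q a (suc (suc k)) ≡ P a (suc (suc k)) * t)
      (sym (trans (IsIntermediate.current num) (cong (intermediate (P a) k) n≡a)))
      (sym (trans (IsIntermediate.current den) (cong (intermediate (Q a) k) n≡a))) refl

    not-convergent : n ℤ.< a (suc k) → ¬ IsRegConvergent a (S c (suc i)) (T c (suc i))
    not-convergent n<a (m , s*q≡p*t) = intermediate-not-convergent a a≥1 k n 1≤n n<a m
      (subst₂ (λ s t → s * Q a (suc m) ≡ P a (suc m) * t)
        (IsIntermediate.current num) (IsIntermediate.current den) s*q≡p*t)

    c≥3 : n ≡ a (suc k) → + 3 ℤ.≤ c (suc i)
    c≥3 n≡a = subst (+ 3 ℤ.≤_) (sym (c≡a+2 n≡a)) (ℤP.+-monoˡ-≤ (+ 2) (a≥1 (suc k)))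

    c≱3 : n ℤ.< a (suc k) → ¬ + 3 ℤ.≤ c (suc i)
    c≱3 n<a 3≤c = ℤP.<⇒≱ (ℤ.+<+ (s≤s (s≤s (s≤s z≤n)))) (subst (+ 3 ℤ.≤_) (c≡2 n<a) 3≤c)

    next : Mediant (suc i)
    next with n ℤ.≟ a (suc k)
    ... | yes n≡a = next-convergent n≡a
    ... | no n≢a = next-intermediate (ℤP.≤∧≢⇒< n≤a n≢a)

    convergent⇔c≥3 : IsRegConvergent a (S c (suc i)) (T c (suc i)) ⇔ (+ 3 ℤ.≤ c (suc i))
    convergent⇔c≥3 with n ℤ.≟ a (suc k)
    ... | yes n≡a = mk⇔ (λ _ → c≥3 n≡a) (λ _ → convergent n≡a)
    ... | no n≢a = mk⇔ (⊥-elim ∘ not-convergent n<a) (⊥-elim ∘ c≱3 n<a)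
      where n<a = ℤP.≤∧≢⇒< n≤a n≢a

  mediant : ∀ i → Mediant i
  mediant zero    = mediant₀
  mediant (suc i) = next (mediant i)

  convergent-within : ∀ d {i} (M : Mediant i) → a (suc (Mediant.k M)) ≡ Mediant.n M + + d →
    ∃ λ j → i ≤ j × IsRegConvergent a (S c (suc j)) (T c (suc j))
  convergent-within zero {i} M a≡n+0 =
    i , ℕP.≤-refl , convergent M (sym (trans a≡n+0 (ℤP.+-identityʳ (Mediant.n M))))
  convergent-within (suc d) {i} M a≡n+1+d =
    let j , i+1≤j , conv = convergent-within d (next-intermediate M n<a) a≡[n+1]+d
    in j , ℕP.<⇒≤ i+1≤j , conv
    where
    n = Mediant.n M
    n<a : n ℤ.< a (suc (Mediant.k M))
    n<a = subst (n ℤ.<_) (sym a≡n+1+d)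
      (subst (ℤ._< n + + suc d) (ℤP.+-identityʳ n) (ℤP.+-monoʳ-< n (ℤ.+<+ (s≤s z≤n))))
    a≡[n+1]+d : a (suc (Mediant.k M)) ≡ n + 1ℤ + + d
    a≡[n+1]+d = trans a≡n+1+d (sym (ℤP.+-assoc n 1ℤ (+ d)))

  convergent-after : ∀ i → ∃ λ j → i ≤ j × IsRegConvergent a (S c (suc j)) (T c (suc j))
  convergent-after i = convergent-within ℤ.∣ a (suc k) - n ∣ M a≡n+∣a-n∣
    where
    M = mediant i
    open Mediant M
    a≡n+∣a-n∣ : a (suc k) ≡ n + + ℤ.∣ a (suc k) - n ∣
    a≡n+∣a-n∣ = trans (sym (identity (a (suc k)) n))
      (cong (λ x → n + x) (sym (ℤP.0≤i⇒+∣i∣≡i (ℤP.i≤j⇒0≤j-i n≤a))))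
      where
      identity : ∀ x y → y + (x - y) ≡ x
      identity = solve-∀

theorem1 : (z : Irrational) (a c : ℕ → ℤ) → IsRegularCF z a → IsNegativeCF z c →
    ((j : ℕ) → 1 ≤ j → (IsRegConvergent a (S c (suc j)) (T c (suc j)) ⇔ (+ 3 ℤ.≤ c (suc j))))
    × ((N : ℕ) → ∃ λ j → N ≤ j × 1 ≤ j × IsRegConvergent a (S c (suc j)) (T c (suc j)))
theorem1 z a c (zs , zs₀ , ⌊zs⌋ , zs-step) (ws , ws₀ , ⌈ws⌉ , ws-step) =
  -- The equivalence holds for j = 0 as well.
  (λ j _ → convergent⇔c≥3 (mediant j)) , infinitely-many
  where
  open Expansions z a c zs zs₀ ⌊zs⌋ zs-step ws ws₀ ⌈ws⌉ ws-step
  infinitely-many : (N : ℕ) → ∃ λ j → N ≤ j × 1 ≤ j × IsRegConvergent a (S c (suc j)) (T c (suc j))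
  infinitely-many N =
    let j , N+1≤j , conv = convergent-after (suc N)
    in j , ℕP.<⇒≤ N+1≤j , ℕP.≤-trans (s≤s z≤n) N+1≤j , conv
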